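{- Let $F$ be a field of characteristic different from $2$ and let $\mathcal H$ be a subring of $F$ with fraction field $F$. Assume that $\Sigma F\subseteq F^2\cdot\big((1+\Sigma F)\cap\mathrm{Jac}(\mathcal H)\big)$. Then $p(F)\leq p^*(\mathcal H)+1$.
   Context: For a commutative ring $R$ and $k\in\mathbb{N}$, $\Sigma_k R$ is the set of sums of $k$ squares in $R$, $\Sigma R=\bigcup_k\Sigma_kR$; $R^\times$ is the unit group and $\mathrm{Jac}(R)=\{x\in R\mid 1-Rx\subseteq R^\times\}$. $F^2$ is the set of squares of $F$. $p(F)=\inf\{k\mid\Sigma F=\Sigma_kF\}\in\mathbb{N}\cup\{\infty\}$ and $p^*(\mathcal H)=\inf\{k\in\mathbb{N}\mid \mathcal H^\times\cap\Sigma F\subseteq\Sigma_kF\}\in\mathbb{N}\cup\{\infty\}$. -}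

module Defs where

open import Level using (Level; _⊔_; suc)
open import Algebra.Bundles using (CommutativeRing)
open import Data.Nat using (ℕ)
open import Data.Fin as Fin using (Fin)
open import Data.Product using (Σ; ∃; ∃-syntax; _×_)
open import Relation.Nullary using (¬_)

module _ {c ℓ : Level} (R : CommutativeRing c ℓ) where
  open CommutativeRing R

  sumF : (k : ℕ) → (Fin k → Carrier) → Carrier
  sumF ℕ.zero    f = 0#
  sumF (ℕ.suc k) f = f Fin.zero + sumF k (λ i → f (Fin.suc i))

  SumOfSquares : ℕ → Carrier → Set (c ⊔ ℓ)
  SumOfSquares k x = Σ (Fin k → Carrier) λ v → x ≈ sumF k (λ i → v i * v i)

  IsSumOfSquares : Carrier → Set (c ⊔ ℓ)
  IsSumOfSquares x = ∃[ k ] SumOfSquares k x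

  IsField : Set (c ⊔ ℓ)
  IsField = (¬ (1# ≈ 0#)) × (∀ x → ¬ (x ≈ 0#) → ∃[ y ] (x * y ≈ 1#))

  CharNot2 : Set ℓ
  CharNot2 = ¬ (1# + 1# ≈ 0#)

  record IsSubring {h : Level} (H : Carrier → Set h) : Set (c ⊔ ℓ ⊔ h) where
    field
      respects : ∀ {x y} → x ≈ y → H x → H y
      has-0    : H 0#
      has-1    : H 1#
      closed-+ : ∀ {x y} → H x → H y → H (x + y)
      closed-- : ∀ {x} → H x → H (- x)
      closed-* : ∀ {x y} → H x → H y → H (x * y)

  FractionFieldIs : {h : Level} (H : Carrier → Set h) → Set (c ⊔ ℓ ⊔ h)
  FractionFieldIs H = ∀ x → ∃[ a ] ∃[ b ] (H a × H b × (¬ (b ≈ 0#)) × (x * b ≈ a))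

  IsUnitIn : {h : Level} (H : Carrier → Set h) → Carrier → Set (c ⊔ ℓ ⊔ h)
  IsUnitIn H x = H x × ∃[ y ] (H y × (x * y ≈ 1#))

  IsInJac : {h : Level} (H : Carrier → Set h) → Carrier → Set (c ⊔ ℓ ⊔ h)
  IsInJac H x = H x × (∀ r → H r → IsUnitIn H (1# - r * x))

  PythagorasNumber≤ : ℕ → Set (c ⊔ ℓ)
  PythagorasNumber≤ k = ∀ x → IsSumOfSquares x → SumOfSquares k x

  PStar≤ : {h : Level} (H : Carrier → Set h) → ℕ → Set (c ⊔ ℓ ⊔ h)
  PStar≤ H k = ∀ x → IsUnitIn H x → IsSumOfSquares x → SumOfSquares k x

  SquareJacHypothesis : {h : Level} (H : Carrier → Set h) → Set (c ⊔ ℓ ⊔ h)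
  SquareJacHypothesis H =
    ∀ s → IsSumOfSquares s →
      ∃[ f ] ∃[ j ] ((∃[ t ] (IsSumOfSquares t × (j ≈ 1# + t))) × IsInJac H j × (s ≈ (f * f) * j))

module Submission where

open import Defs
open import Level using (Level)
open import Algebra.Bundles using (CommutativeRing)
open import Data.Nat using (ℕ; zero; suc)
open import Data.Fin using (Fin)
open import Data.Product using (_,_)
import Algebra.Properties.Ring as RingProperties
import Algebra.Properties.AbelianGroup as AbelianGroupProperties
import Algebra.Properties.CommutativeSemigroup as CommutativeSemigroupProperties
import Relation.Binary.Reasoning.Setoid as SetoidReasoning

-- Writing the given sum of squares as s = f² (1 + t) with 1 + t ∈ Jac(H), the element
-- t = -(1 - (1 + t)) is a unit of H and a sum of squares, hence t ∈ Σ_k F by the bound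
-- on p*(H); then s = f² + Σ (f vᵢ)² ∈ Σ_{k+1} F.

module _ {c ℓ : Level} (F : CommutativeRing c ℓ) where
  open CommutativeRing F
  open SetoidReasoning setoid
  open CommutativeSemigroupProperties *-commutativeSemigroup using (interchange)

  sumF-scale-squares : ∀ (f : Carrier) k (g : Fin k → Carrier) →
    sumF F k (λ i → (f * g i) * (f * g i)) ≈ (f * f) * sumF F k (λ i → g i * g i)
  sumF-scale-squares f zero    g = sym (zeroʳ (f * f))
  sumF-scale-squares f (suc k) g = begin
    (f * g Fin.zero) * (f * g Fin.zero) + sumF F k (λ i → (f * g (Fin.suc i)) * (f * g (Fin.suc i)))
      ≈⟨ +-cong (interchange f (g Fin.zero) f (g Fin.zero)) (sumF-scale-squares f k (λ i → g (Fin.suc i))) ⟩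
    (f * f) * (g Fin.zero * g Fin.zero) + (f * f) * sumF F k (λ i → g (Fin.suc i) * g (Fin.suc i))
      ≈⟨ distribˡ (f * f) _ _ ⟨
    (f * f) * sumF F (suc k) (λ i → g i * g i) ∎

  SumOfSquares-resp-≈ : ∀ {k x y} → x ≈ y → SumOfSquares F k x → SumOfSquares F k y
  SumOfSquares-resp-≈ x≈y (v , x≈Σv²) = v , trans (sym x≈y) x≈Σv²

  SumOfSquares-square* : ∀ {k t} f → SumOfSquares F k t → SumOfSquares F k ((f * f) * t)
  SumOfSquares-square* {k} {t} f (v , t≈Σv²) = (λ i → f * v i) , (begin
    (f * f) * t                              ≈⟨ *-congˡ t≈Σv² ⟩
    (f * f) * sumF F k (λ i → v i * v i)     ≈⟨ sumF-scale-squares f k v ⟨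
    sumF F k (λ i → (f * v i) * (f * v i))   ∎)

  SumOfSquares-square+ : ∀ {k t} a → SumOfSquares F k t → SumOfSquares F (suc k) (a * a + t)
  SumOfSquares-square+ a (v , t≈Σv²) = a∷v , +-congˡ t≈Σv²
    where
    a∷v : Fin (suc _) → Carrier
    a∷v Fin.zero    = a
    a∷v (Fin.suc i) = v i

  SumOfSquares-square*1+ : ∀ {k t} f → SumOfSquares F k t → SumOfSquares F (suc k) ((f * f) * (1# + t))
  SumOfSquares-square*1+ {t = t} f t∈Σₖ =
    SumOfSquares-resp-≈
      (trans (+-congʳ (sym (*-identityʳ (f * f)))) (sym (distribˡ (f * f) 1# t)))
      (SumOfSquares-square+ f (SumOfSquares-square* f t∈Σₖ))

  module _ {h : Level} {H : Carrier → Set h} (H-subring : IsSubring F H) where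
    open IsSubring H-subring
    open RingProperties ring using (-‿distribˡ-*; -‿distribʳ-*; -‿involutive)
    open AbelianGroupProperties +-abelianGroup using (⁻¹-anti-homo‿-; xyx⁻¹≈y)

    IsUnitIn-resp-≈ : ∀ {x y} → x ≈ y → IsUnitIn F H x → IsUnitIn F H y
    IsUnitIn-resp-≈ x≈y (Hx , x⁻¹ , Hx⁻¹ , xx⁻¹≈1) =
      respects x≈y Hx , x⁻¹ , Hx⁻¹ , trans (*-congʳ (sym x≈y)) xx⁻¹≈1

    IsUnitIn-neg : ∀ {x} → IsUnitIn F H x → IsUnitIn F H (- x)
    IsUnitIn-neg {x} (Hx , x⁻¹ , Hx⁻¹ , xx⁻¹≈1) = closed-- Hx , - x⁻¹ , closed-- Hx⁻¹ , (begin
      (- x) * (- x⁻¹)  ≈⟨ -‿distribˡ-* x (- x⁻¹) ⟨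
      - (x * (- x⁻¹))  ≈⟨ -‿cong (-‿distribʳ-* x x⁻¹) ⟨
      - (- (x * x⁻¹))  ≈⟨ -‿involutive (x * x⁻¹) ⟩
      x * x⁻¹          ≈⟨ xx⁻¹≈1 ⟩
      1#               ∎)

    IsInJac⇒pred-IsUnitIn : ∀ {j t} → j ≈ 1# + t → IsInJac F H j → IsUnitIn F H t
    IsInJac⇒pred-IsUnitIn {j} {t} j≈1+t (_ , 1-H·j⊆H×) =
      IsUnitIn-resp-≈ -[1-1·j]≈t (IsUnitIn-neg (1-H·j⊆H× 1# has-1))
      where
      -[1-1·j]≈t : - (1# - 1# * j) ≈ t
      -[1-1·j]≈t = begin
        - (1# - 1# * j)  ≈⟨ ⁻¹-anti-homo‿- 1# (1# * j) ⟩
        1# * j - 1#      ≈⟨ +-congʳ (*-identityˡ j) ⟩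
        j - 1#           ≈⟨ +-congʳ j≈1+t ⟩
        1# + t - 1#      ≈⟨ xyx⁻¹≈y 1# t ⟩
        t                ∎

proposition2p1 : {c ℓ h : Level} (F : CommutativeRing c ℓ) → IsField F → CharNot2 F → (H : CommutativeRing.Carrier F → Set h) → IsSubring F H → FractionFieldIs F H → SquareJacHypothesis F H → (k : ℕ) → PStar≤ F H k → PythagorasNumber≤ F (suc k)
proposition2p1 F _ _ H H-subring _ Σ⊆F²·[[1+Σ]∩Jac] k p*≤k s s∈Σ
  with Σ⊆F²·[[1+Σ]∩Jac] s s∈Σ
... | f , j , (t , t∈Σ , j≈1+t) , j∈Jac , s≈f²j =
  SumOfSquares-resp-≈ F (sym s≈f²[1+t]) (SumOfSquares-square*1+ F f t∈Σₖ)
  where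
  open CommutativeRing F using (_≈_; _*_; _+_; 1#; sym; trans; *-congˡ)
  s≈f²[1+t] : s ≈ (f * f) * (1# + t)
  s≈f²[1+t] = trans s≈f²j (*-congˡ j≈1+t)
  t∈Σₖ : SumOfSquares F k t
  t∈Σₖ = p*≤k t (IsInJac⇒pred-IsUnitIn F H-subring j≈1+t j∈Jac) t∈Σ
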